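{- Let $n\ge2$ be even. If $z\in\tilde I^{\mathsf{FPF}}_n$ and $w\in\tilde S_n$, then $\mathrm{sgn}_{\mathsf{FPF}}(wzw^{ -1})=\mathrm{sgn}_{\mathsf{FPF}}(z)$.
   Context: $\tilde S_n$ is the group of bijections $\pi:\mathbb Z\to\mathbb Z$ with $\pi(i+n)=\pi(i)+n$ for all $i$ and $\sum_{i=1}^n\pi(i)=\sum_{i=1}^n i$. $\tilde I^{\mathsf{FPF}}_n$ is the set of $z\in\tilde S_n$ with $z(z(i))=i\ne z(i)$ for all $i$. For $k\in\mathbb Z$, $r_n(k)$ is the unique element of $\{1,\dots,n\}$ congruent to $k$ mod $n$. For $\pi\in\tilde S_n$, $\beta(\pi)=\frac1{2n}\sum_{i=1}^n|\pi(i)-r_n(\pi(i))|$, and for $z\in\tilde I^{\mathsf{FPF}}_n$, $\mathrm{sgn}_{\mathsf{FPF}}(z)=(-1)^{\beta(z)}$ (here $\beta(z)$ is an integer). -}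

module Defs where

open import Data.Nat as ℕ using (ℕ; suc; NonZero)
open import Data.Nat.Properties using (m*n≢0)
open import Data.Integer as ℤ using (ℤ; +_; _-_; -1ℤ; 1ℤ; ∣_∣)
open import Data.Integer.DivMod using (_%ℕ_)
open import Data.List using (List; map; foldr; upTo)
open import Data.Product using (_×_)
open import Function using (_∘_)
open import Function.Definitions using (Bijective)
open import Relation.Binary.PropositionalEquality using (_≡_)

sumℤ : ℕ → (ℤ → ℤ) → ℤ
sumℤ n f = foldr ℤ._+_ (+ 0) (map (λ k → f (+ suc k)) (upTo n))

IsAffinePerm : ℕ → (ℤ → ℤ) → Set
IsAffinePerm n π =
  Bijective _≡_ _≡_ π
  × (∀ i → π (i ℤ.+ + n) ≡ π i ℤ.+ + n)
  × (sumℤ n π ≡ sumℤ n (λ i → i))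

IsAffineFPFInvolution : ℕ → (ℤ → ℤ) → Set
IsAffineFPFInvolution n z =
  IsAffinePerm n z × (∀ i → z (z i) ≡ i) × (∀ i → (z i ≡ i → Data.Empty.⊥))
  where import Data.Empty

r : (n : ℕ) .{{_ : NonZero n}} → ℤ → ℤ
r n k = + suc ((k - 1ℤ) %ℕ n)

βsum : (n : ℕ) .{{_ : NonZero n}} → (ℤ → ℤ) → ℕ
βsum n π = ∣ sumℤ n (λ i → + ∣ π i - r n (π i) ∣) ∣

-- β(π) = βsum / (2n)  (an exact division for FPF involutions)
β : (n : ℕ) .{{_ : NonZero n}} → (ℤ → ℤ) → ℕ
β n π = ℕ._/_ (βsum n π) (2 ℕ.* n) {{m*n≢0 2 n}}

sgnFPF : (n : ℕ) .{{_ : NonZero n}} → (ℤ → ℤ) → ℤ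
sgnFPF n z = -1ℤ ℤ.^ β n z

-- For a map σ : ℤ → ℤ commuting with translation by n, write x = r_n(x) + n·⌊(x−1)/n⌋ and let
-- δσ(i) = ⌊(σ(i)−1)/n⌋ − ⌊(i−1)/n⌋ be the number of windows by which σ moves i; δσ is n-periodic,
-- and on {1,…,n} it is the window index of σ(i), so Σ_{i=1}^n |σ(i) − r_n(σ(i))| = n·Σ|δσ|.
-- For z ∈ Ĩ^FPF_n we have δz∘z = −δz, and z pairs up the residues mod n, so the window sum of
-- any z-invariant periodic function is twice a half-sum: Σ|δz| = 2H with β(z) = H, and since
-- x² = |x| + 2·C(|x|,2) also Σδz² ≡ 2β(z) (mod 4).
-- For z′ = wzw⁻¹ one has δz′(w j) = δz(j) + δw(z j) − δw(j). Expanding the square, Σ(δw∘z)² =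
-- Σδw² = Σδw + 2·ΣC(δw,2) with Σδw = 0 (the sum condition on w), Σδz·(δw∘z) = −Σδz·δw, and
-- Σ(δw∘z)·δw is again a doubled half-sum. Hence Σδz′² ≡ Σδz² (mod 4), so β(z′) ≡ β(z) (mod 2).
module Submission where

open import Defs
open import Data.Nat using (ℕ; NonZero; _≤_)
open import Data.Nat.Divisibility using (_∣_)
open import Data.Integer using (ℤ)
open import Function using (_∘_)
open import Relation.Binary.PropositionalEquality using (_≡_)

open import Data.Empty using (⊥-elim)
open import Data.Fin using (Fin; toℕ; fromℕ<)
open import Data.Fin.Permutation as Perm using (Permutation)
import Data.Fin.Properties as FinP
open import Data.Integer as ℤ using (+_; -[1+_]; _-_; 1ℤ; -1ℤ; ∣_∣; _+_; _*_; -_)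
open import Data.Integer.DivMod using (_%ℕ_; _/ℕ_; a≡a%ℕn+[a/ℕn]*n; n%ℕd<d)
import Data.Integer.Properties as ℤP
open import Algebra.Properties.AbelianGroup ℤP.+-0-abelianGroup using () renaming (∙-cancelˡ to +-cancelˡ)
open import Algebra.Properties.Semiring.Sum ℤP.+-*-semiring
  using (sum; ∑-distrib-+; *-distribˡ-sum; sum-cong-≗; ∑-permute)
open import Data.Integer.Tactic.RingSolver using (solve-∀)
open import Data.List using (map; foldr; applyUpTo)
open import Data.Nat as ℕ using (zero; suc)
import Data.Nat.DivMod as ℕDM
import Data.Nat.Properties as ℕP
import Data.Nat.Tactic.RingSolver as ℕSolver
open import Data.Product using (_×_; _,_; proj₁; proj₂)
open import Relation.Binary.PropositionalEquality
  using (_≢_; refl; sym; trans; cong; cong₂; module ≡-Reasoning)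
open import Relation.Nullary using (yes; no)

altSign : ℤ → ℤ
altSign x = -1ℤ ℤ.^ ∣ x ∣

-1*-1*-cancel : ∀ y → -1ℤ * (-1ℤ * y) ≡ y
-1*-1*-cancel = solve-∀

altSign-+2 : ∀ x → altSign (x + + 2) ≡ altSign x
altSign-+2 (+ m) = trans (cong (-1ℤ ℤ.^_) (ℕP.+-comm m 2)) (-1*-1*-cancel (-1ℤ ℤ.^ m))
altSign-+2 -[1+ zero ] = refl
altSign-+2 -[1+ suc zero ] = refl
altSign-+2 -[1+ suc (suc m) ] = sym (-1*-1*-cancel (-1ℤ ℤ.^ suc m))

altSign-+-2*ℕ : ∀ x k → altSign (x + + 2 * + k) ≡ altSign x
altSign-+-2*ℕ x zero = cong altSign (ℤP.+-identityʳ x)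
altSign-+-2*ℕ x (suc k) = begin
  altSign (x + + 2 * + suc k)    ≡⟨ cong altSign (e x (+ k)) ⟩
  altSign (x + + 2 * + k + + 2)  ≡⟨ altSign-+2 (x + + 2 * + k) ⟩
  altSign (x + + 2 * + k)        ≡⟨ altSign-+-2*ℕ x k ⟩
  altSign x                      ∎
  where
  open ≡-Reasoning
  e : ∀ x k → x + + 2 * (1ℤ + k) ≡ x + + 2 * k + + 2
  e = solve-∀

altSign-+-even : ∀ x m → altSign (x + + 2 * m) ≡ altSign x
altSign-+-even x (+ k) = altSign-+-2*ℕ x k
altSign-+-even x -[1+ k ] =
  sym (trans (cong altSign (e x (+ suc k))) (altSign-+-2*ℕ (x + + 2 * -[1+ k ]) (suc k)))
  where
  e : ∀ x k → x ≡ x + + 2 * - k + + 2 * k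
  e = solve-∀

choose₂ : ℕ → ℕ
choose₂ zero = 0
choose₂ (suc m) = m ℕ.+ choose₂ m

choose₂ℤ : ℤ → ℤ
choose₂ℤ (+ m) = + choose₂ m
choose₂ℤ -[1+ m ] = + choose₂ (suc (suc m))

square≡self+2*choose₂ℕ : ∀ m → + m * + m ≡ + m + + 2 * + choose₂ m
square≡self+2*choose₂ℕ zero = refl
square≡self+2*choose₂ℕ (suc m) = begin
  (1ℤ + + m) * (1ℤ + + m)                     ≡⟨ e₁ (+ m) ⟩
  1ℤ + + m + + m + + m * + m                  ≡⟨ cong (_+_ (1ℤ + + m + + m)) (square≡self+2*choose₂ℕ m) ⟩
  1ℤ + + m + + m + (+ m + + 2 * + choose₂ m)  ≡⟨ e₂ (+ m) (+ choose₂ m) ⟩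
  1ℤ + + m + + 2 * (+ m + + choose₂ m)        ≡⟨ cong (λ u → 1ℤ + + m + + 2 * u) (ℤP.pos-+ m (choose₂ m)) ⟨
  + suc m + + 2 * + choose₂ (suc m)           ∎
  where
  open ≡-Reasoning
  e₁ : ∀ M → (1ℤ + M) * (1ℤ + M) ≡ 1ℤ + M + M + M * M
  e₁ = solve-∀
  e₂ : ∀ M c → 1ℤ + M + M + (M + + 2 * c) ≡ 1ℤ + M + + 2 * (M + c)
  e₂ = solve-∀

square≡self+2*choose₂ : ∀ x → x * x ≡ x + + 2 * choose₂ℤ x
square≡self+2*choose₂ (+ m) = square≡self+2*choose₂ℕ m
square≡self+2*choose₂ -[1+ m ] = begin
  + suc m * + suc m                         ≡⟨ square≡self+2*choose₂ℕ (suc m) ⟩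
  + suc m + + 2 * + c                       ≡⟨ e (+ suc m) (+ c) ⟩
  - + suc m + + 2 * (+ suc m + + c)         ≡⟨ cong (λ u → -[1+ m ] + + 2 * u) (ℤP.pos-+ (suc m) c) ⟨
  -[1+ m ] + + 2 * + choose₂ (suc (suc m))  ∎
  where
  open ≡-Reasoning
  c = choose₂ (suc m)
  e : ∀ M c → M + + 2 * c ≡ - M + + 2 * (M + c)
  e = solve-∀

square≡abs+2*choose₂ : ∀ x → x * x ≡ + ∣ x ∣ + + 2 * choose₂ℤ (+ ∣ x ∣)
square≡abs+2*choose₂ (+ m) = square≡self+2*choose₂ℕ m
square≡abs+2*choose₂ -[1+ m ] = square≡self+2*choose₂ℕ (suc m)

foldr-+-applyUpTo≡sum : (h : ℕ → ℤ) (g : ℕ → ℕ) (m : ℕ) →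
                        foldr _+_ (+ 0) (map h (applyUpTo g m)) ≡ sum (λ (k : Fin m) → h (g (toℕ k)))
foldr-+-applyUpTo≡sum h g zero = refl
foldr-+-applyUpTo≡sum h g (suc m) = cong (_+_ (h (g 0))) (foldr-+-applyUpTo≡sum h (g ∘ suc) m)

ifLess : ℕ → ℕ → ℤ → ℤ
ifLess a b v with a ℕ.<? b
... | yes _ = v
... | no _ = + 0

≢⇒≡ifLess+ifLess : ∀ {a b} v → a ≢ b → v ≡ ifLess a b v + ifLess b a v
≢⇒≡ifLess+ifLess {a} {b} v a≢b with a ℕ.<? b | b ℕ.<? a
... | yes a<b | yes b<a = ⊥-elim (ℕP.<-asym a<b b<a)
... | yes _   | no _    = sym (ℤP.+-identityʳ v)
... | no _    | yes _   = sym (ℤP.+-identityˡ v)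
... | no a≮b  | no b≮a  = ⊥-elim (a≢b (ℕP.≤-antisym (ℕP.≮⇒≥ b≮a) (ℕP.≮⇒≥ a≮b)))

module Windows (n : ℕ) .{{_ : NonZero n}} where

  N : ℤ
  N = + n

  Periodic : (ℤ → ℤ) → Set
  Periodic f = ∀ i → f (i + N) ≡ f i

  Equivariant : (ℤ → ℤ) → Set
  Equivariant σ = ∀ i → σ (i + N) ≡ σ i + N

  inverse-equivariant : ∀ σ τ → Equivariant σ → (∀ i → σ (τ i) ≡ i) → (∀ i → τ (σ i) ≡ i) →
                        Equivariant τ
  inverse-equivariant σ τ σ-eq στ τσ i = begin
    τ (i + N)        ≡⟨ cong (λ u → τ (u + N)) (στ i) ⟨
    τ (σ (τ i) + N)  ≡⟨ cong τ (σ-eq (τ i)) ⟨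
    τ (σ (τ i + N))  ≡⟨ τσ (τ i + N) ⟩
    τ i + N          ∎
    where open ≡-Reasoning

  translate-by-multiple : ∀ f c → (∀ i → f (i + N) ≡ f i + c) → ∀ i m → f (i + m * N) ≡ f i + m * c
  translate-by-multiple f c step i (+ k) = translate-by-ℕ k
    where
    open ≡-Reasoning
    e₁ : ∀ i k N → i + (1ℤ + k) * N ≡ i + k * N + N
    e₁ = solve-∀
    e₂ : ∀ a k c → a + k * c + c ≡ a + (1ℤ + k) * c
    e₂ = solve-∀
    translate-by-ℕ : ∀ k → f (i + + k * N) ≡ f i + + k * c
    translate-by-ℕ zero = trans (cong f (ℤP.+-identityʳ i)) (sym (ℤP.+-identityʳ (f i)))
    translate-by-ℕ (suc k) = begin
      f (i + + suc k * N)  ≡⟨ cong f (e₁ i (+ k) N) ⟩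
      f (i + + k * N + N)  ≡⟨ step _ ⟩
      f (i + + k * N) + c  ≡⟨ cong (_+ c) (translate-by-ℕ k) ⟩
      f i + + k * c + c    ≡⟨ e₂ (f i) (+ k) c ⟩
      f i + + suc k * c    ∎
  translate-by-multiple f c step i -[1+ k ] = begin
    f j                                        ≡⟨ e₁ (f j) (+ suc k) c ⟩
    f j + + suc k * c + -[1+ k ] * c           ≡⟨ cong (_+ -[1+ k ] * c) (translate-by-multiple f c step j (+ suc k)) ⟨
    f (j + + suc k * N) + -[1+ k ] * c         ≡⟨ cong (λ u → f u + -[1+ k ] * c) (e₂ i (+ suc k) N) ⟩
    f i + -[1+ k ] * c                         ∎
    where
    open ≡-Reasoning
    j = i + -[1+ k ] * N
    e₁ : ∀ a k c → a ≡ a + k * c + - k * c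
    e₁ = solve-∀
    e₂ : ∀ i k N → i + - k * N + k * N ≡ i
    e₂ = solve-∀

  -- r n x unfolds to + suc (residue x), the paper's r_n(x).
  residue : ℤ → ℕ
  residue x = (x - 1ℤ) %ℕ n

  window : ℤ → ℤ
  window x = (x - 1ℤ) /ℕ n

  residue<n : ∀ x → residue x ℕ.< n
  residue<n x = n%ℕd<d (x - 1ℤ) n

  decomposition : ∀ x → x ≡ r n x + window x * N
  decomposition x = begin
    x                                   ≡⟨ e x ⟩
    1ℤ + (x - 1ℤ)                       ≡⟨ cong (_+_ 1ℤ) (a≡a%ℕn+[a/ℕn]*n (x - 1ℤ) n) ⟩
    1ℤ + (+ residue x + window x * N)   ≡⟨ ℤP.+-assoc 1ℤ (+ residue x) (window x * N) ⟨
    r n x + window x * N                ∎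
    where
    open ≡-Reasoning
    e : ∀ x → x ≡ 1ℤ + (x - 1ℤ)
    e = solve-∀

  <n≢+positive-multiple : ∀ {a} b k → a ℕ.< n → + a ≢ + b + + suc k * N
  <n≢+positive-multiple {a} b k a<n eq = ℕP.<⇒≱ a<n (begin
    n                  ≤⟨ ℕP.m≤m+n n (k ℕ.* n) ⟩
    suc k ℕ.* n        ≤⟨ ℕP.m≤n+m _ b ⟩
    b ℕ.+ suc k ℕ.* n  ≡⟨ ℤP.+-injective b+kn≡a ⟩
    a                  ∎)
    where
    open ℕP.≤-Reasoning
    b+kn≡a : + (b ℕ.+ suc k ℕ.* n) ≡ + a
    b+kn≡a = trans (ℤP.pos-+ b _) (trans (cong (_+_ (+ b)) (ℤP.pos-* (suc k) n)) (sym eq))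

  <n-differ-by-multiple⇒0 : ∀ {a b} m → a ℕ.< n → b ℕ.< n → + a ≡ + b + m * N → m ≡ + 0
  <n-differ-by-multiple⇒0 (+ zero) _ _ _ = refl
  <n-differ-by-multiple⇒0 (+ suc k) a<n _ eq = ⊥-elim (<n≢+positive-multiple _ k a<n eq)
  <n-differ-by-multiple⇒0 {a} {b} -[1+ k ] _ b<n eq =
    ⊥-elim (<n≢+positive-multiple _ k b<n (sym (trans (cong (_+ + suc k * N) eq) (e (+ b) (+ suc k) N))))
    where
    e : ∀ b k N → b + - k * N + k * N ≡ b
    e = solve-∀

  decomposition-unique : ∀ {a b} q q' → a ℕ.< n → b ℕ.< n →
                         + suc a + q * N ≡ + suc b + q' * N → a ≡ b × q ≡ q'
  decomposition-unique {a} {b} q q' a<n b<n eq =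
    ℤP.+-injective (trans a≡b+dN (trans (cong (λ u → + b + u * N) d≡0) (ℤP.+-identityʳ (+ b)))) ,
    trans (sym (ℤP.+-identityʳ q)) (trans (cong (_+_ q) (sym d≡0)) (e₃ q q'))
    where
    e₁ : ∀ a q N → a ≡ 1ℤ + a + q * N - 1ℤ - q * N
    e₁ = solve-∀
    e₂ : ∀ b q q' N → 1ℤ + b + q' * N - 1ℤ - q * N ≡ b + (q' - q) * N
    e₂ = solve-∀
    e₃ : ∀ q q' → q + (q' - q) ≡ q'
    e₃ = solve-∀
    a≡b+dN : + a ≡ + b + (q' - q) * N
    a≡b+dN = trans (e₁ (+ a) q N) (trans (cong (λ u → u - 1ℤ - q * N) eq) (e₂ (+ b) q q' N))
    d≡0 : q' - q ≡ + 0
    d≡0 = <n-differ-by-multiple⇒0 (q' - q) a<n b<n a≡b+dN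

  residue-window-+-multiple : ∀ x m → residue (x + m * N) ≡ residue x × window (x + m * N) ≡ window x + m
  residue-window-+-multiple x m =
    decomposition-unique _ _ (residue<n (x + m * N)) (residue<n x) (begin
      r n (x + m * N) + window (x + m * N) * N  ≡⟨ decomposition (x + m * N) ⟨
      x + m * N                                 ≡⟨ cong (_+ m * N) (decomposition x) ⟩
      r n x + window x * N + m * N              ≡⟨ e (r n x) (window x) m N ⟩
      r n x + (window x + m) * N                ∎)
    where
    open ≡-Reasoning
    e : ∀ a d m N → a + d * N + m * N ≡ a + (d + m) * N
    e = solve-∀

  residue-+N : ∀ x → residue (x + N) ≡ residue x
  residue-+N x = trans (cong (λ u → residue (x + u)) (sym (ℤP.*-identityˡ N)))
                       (proj₁ (residue-window-+-multiple x 1ℤ))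

  window-+N : ∀ x → window (x + N) ≡ window x + 1ℤ
  window-+N x = trans (cong (λ u → window (x + u)) (sym (ℤP.*-identityˡ N)))
                      (proj₂ (residue-window-+-multiple x 1ℤ))

  ι : Fin n → ℤ
  ι k = + suc (toℕ k)

  residue-window-ι : ∀ k → residue (ι k) ≡ toℕ k × window (ι k) ≡ + 0
  residue-window-ι k = decomposition-unique (window (ι k)) (+ 0) (residue<n (ι k)) (FinP.toℕ<n k)
                         (trans (sym (decomposition (ι k))) (sym (ℤP.+-identityʳ (ι k))))

  periodic-residue : ∀ f → Periodic f → ∀ x → f x ≡ f (r n x)
  periodic-residue f f-per x = begin
    f x                            ≡⟨ cong f (decomposition x) ⟩
    f (r n x + window x * N)       ≡⟨ translate-by-multiple f (+ 0) step _ (window x) ⟩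
    f (r n x) + window x * + 0     ≡⟨ cong (_+_ (f (r n x))) (ℤP.*-zeroʳ (window x)) ⟩
    f (r n x) + + 0                ≡⟨ ℤP.+-identityʳ _ ⟩
    f (r n x)                      ∎
    where
    open ≡-Reasoning
    step : ∀ i → f (i + N) ≡ f i + + 0
    step i = trans (f-per i) (sym (ℤP.+-identityʳ (f i)))

  residue-equivariant : ∀ σ → Equivariant σ → ∀ x → residue (σ (r n x)) ≡ residue (σ x)
  residue-equivariant σ σ-eq x = sym (begin
    residue (σ x)                       ≡⟨ cong (residue ∘ σ) (decomposition x) ⟩
    residue (σ (r n x + window x * N))  ≡⟨ cong residue (translate-by-multiple σ N σ-eq _ (window x)) ⟩
    residue (σ (r n x) + window x * N)  ≡⟨ proj₁ (residue-window-+-multiple (σ (r n x)) (window x)) ⟩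
    residue (σ (r n x))                 ∎)
    where open ≡-Reasoning

  Σ : (ℤ → ℤ) → ℤ
  Σ f = sum (f ∘ ι)

  sumℤ≡Σ : ∀ f → sumℤ n f ≡ Σ f
  sumℤ≡Σ f = foldr-+-applyUpTo≡sum (λ k → f (+ suc k)) (λ k → k) n

  Σ-+ : ∀ f g → Σ (λ i → f i + g i) ≡ Σ f + Σ g
  Σ-+ f g = ∑-distrib-+ (f ∘ ι) (g ∘ ι)

  Σ-*ˡ : ∀ c f → Σ (λ i → c * f i) ≡ c * Σ f
  Σ-*ˡ c f = sym (*-distribˡ-sum c (f ∘ ι))

  Σ-+-*ˡ : ∀ f c g → Σ (λ i → f i + c * g i) ≡ Σ f + c * Σ g
  Σ-+-*ˡ f c g = trans (Σ-+ f (λ i → c * g i)) (cong (_+_ (Σ f)) (Σ-*ˡ c g))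

  residueMap : (ℤ → ℤ) → Fin n → Fin n
  residueMap ρ k = fromℕ< (residue<n (ρ (ι k)))

  ι-residueMap : ∀ ρ k → ι (residueMap ρ k) ≡ r n (ρ (ι k))
  ι-residueMap ρ k = cong (+_ ∘ suc) (FinP.toℕ-fromℕ< (residue<n (ρ (ι k))))

  residueMap-inverse : ∀ ρ ρ' → Equivariant ρ → (∀ i → ρ (ρ' i) ≡ i) →
                       ∀ k → residueMap ρ (residueMap ρ' k) ≡ k
  residueMap-inverse ρ ρ' ρ-eq ρρ' k = FinP.toℕ-injective (begin
    toℕ (residueMap ρ (residueMap ρ' k))  ≡⟨ FinP.toℕ-fromℕ< _ ⟩
    residue (ρ (ι (residueMap ρ' k)))     ≡⟨ cong (residue ∘ ρ) (ι-residueMap ρ' k) ⟩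
    residue (ρ (r n (ρ' (ι k))))          ≡⟨ residue-equivariant ρ ρ-eq (ρ' (ι k)) ⟩
    residue (ρ (ρ' (ι k)))                ≡⟨ cong residue (ρρ' (ι k)) ⟩
    residue (ι k)                         ≡⟨ proj₁ (residue-window-ι k) ⟩
    toℕ k                                 ∎)
    where open ≡-Reasoning

  Σ-∘-bijection : ∀ σ τ → Equivariant σ → (∀ i → σ (τ i) ≡ i) → (∀ i → τ (σ i) ≡ i) →
                  ∀ f → Periodic f → Σ (f ∘ σ) ≡ Σ f
  Σ-∘-bijection σ τ σ-eq στ τσ f f-per = begin
    sum (λ k → f (σ (ι k)))             ≡⟨ sum-cong-≗ (λ k → periodic-residue f f-per (σ (ι k))) ⟩
    sum (λ k → f (r n (σ (ι k))))       ≡⟨ sum-cong-≗ (λ k → cong f (ι-residueMap σ k)) ⟨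
    sum (λ k → f (ι (residueMap σ k)))  ≡⟨ ∑-permute (f ∘ ι) residuePermutation ⟨
    Σ f                                 ∎
    where
    open ≡-Reasoning
    residuePermutation : Permutation n n
    residuePermutation = Perm.permutation (residueMap σ) (residueMap τ)
      (residueMap-inverse σ τ σ-eq στ) (residueMap-inverse τ σ (inverse-equivariant σ τ σ-eq στ τσ) τσ)

  same-residue⇒+multiple : ∀ x y → residue x ≡ residue y → x ≡ y + (window x - window y) * N
  same-residue⇒+multiple x y eq = begin
    x                                                 ≡⟨ decomposition x ⟩
    r n x + window x * N                              ≡⟨ cong (λ u → + suc u + window x * N) eq ⟩
    r n y + window x * N                              ≡⟨ e (r n y) (window x) (window y) N ⟩
    r n y + window y * N + (window x - window y) * N  ≡⟨ cong (_+ (window x - window y) * N) (decomposition y) ⟨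
    y + (window x - window y) * N                     ∎
    where
    open ≡-Reasoning
    e : ∀ a p q N → a + p * N ≡ a + q * N + (p - q) * N
    e = solve-∀

  displacement : (ℤ → ℤ) → ℤ → ℤ
  displacement σ i = window (σ i) - window i

  displacement-periodic : ∀ σ → Equivariant σ → Periodic (displacement σ)
  displacement-periodic σ σ-eq i = begin
    window (σ (i + N)) - window (i + N)  ≡⟨ cong₂ (λ u v → window u - v) (σ-eq i) (window-+N i) ⟩
    window (σ i + N) - (window i + 1ℤ)   ≡⟨ cong (_- (window i + 1ℤ)) (window-+N (σ i)) ⟩
    window (σ i) + 1ℤ - (window i + 1ℤ)  ≡⟨ e (window (σ i)) (window i) ⟩
    window (σ i) - window i              ∎
    where
    open ≡-Reasoning
    e : ∀ a b → a + 1ℤ - (b + 1ℤ) ≡ a - b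
    e = solve-∀

  displacement-ι : ∀ σ k → displacement σ (ι k) ≡ window (σ (ι k))
  displacement-ι σ k = trans (cong (_-_ (window (σ (ι k)))) (proj₂ (residue-window-ι k))) (ℤP.+-identityʳ _)

  sumℤ-distance-to-r≡N*Σ∣displacement∣ : ∀ σ →
    sumℤ n (λ i → + ∣ σ i - r n (σ i) ∣) ≡ N * Σ (λ i → + ∣ displacement σ i ∣)
  sumℤ-distance-to-r≡N*Σ∣displacement∣ σ = begin
    sumℤ n (λ i → + ∣ σ i - r n (σ i) ∣)  ≡⟨ sumℤ≡Σ (λ i → + ∣ σ i - r n (σ i) ∣) ⟩
    Σ (λ i → + ∣ σ i - r n (σ i) ∣)       ≡⟨ sum-cong-≗ distance≡∣displacement∣*N ⟩
    Σ (λ i → + ∣ displacement σ i ∣ * N)  ≡⟨ sum-cong-≗ (λ k → ℤP.*-comm (+ ∣ displacement σ (ι k) ∣) N) ⟩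
    Σ (λ i → N * + ∣ displacement σ i ∣)  ≡⟨ Σ-*ˡ N (λ i → + ∣ displacement σ i ∣) ⟩
    N * Σ (λ i → + ∣ displacement σ i ∣)  ∎
    where
    open ≡-Reasoning
    e : ∀ a b → a + b - a ≡ b
    e = solve-∀
    distance≡∣displacement∣*N : ∀ k → + ∣ σ (ι k) - r n (σ (ι k)) ∣ ≡ + ∣ displacement σ (ι k) ∣ * N
    distance≡∣displacement∣*N k = begin
      + ∣ x - r n x ∣                   ≡⟨ cong (+_ ∘ ∣_∣ ∘ (_- r n x)) (decomposition x) ⟩
      + ∣ r n x + window x * N - r n x ∣ ≡⟨ cong (+_ ∘ ∣_∣) (e (r n x) (window x * N)) ⟩
      + ∣ window x * N ∣                ≡⟨ cong (λ u → + ∣ u * N ∣) (displacement-ι σ k) ⟨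
      + ∣ displacement σ (ι k) * N ∣    ≡⟨ cong +_ (ℤP.abs-* (displacement σ (ι k)) N) ⟩
      + (∣ displacement σ (ι k) ∣ ℕ.* n) ≡⟨ ℤP.pos-* ∣ displacement σ (ι k) ∣ n ⟩
      + ∣ displacement σ (ι k) ∣ * N    ∎
      where x = σ (ι k)

  Σ-displacement≡0 : ∀ σ τ → Equivariant σ → (∀ i → σ (τ i) ≡ i) → (∀ i → τ (σ i) ≡ i) →
                     Σ σ ≡ Σ (λ i → i) → Σ (displacement σ) ≡ + 0
  Σ-displacement≡0 σ τ σ-eq στ τσ Σσ≡Σid = begin
    Σ (displacement σ)  ≡⟨ sum-cong-≗ (displacement-ι σ) ⟩
    Σ (window ∘ σ)      ≡⟨ ℤP.*-cancelʳ-≡ _ (+ 0) N (trans (ℤP.*-comm (Σ (window ∘ σ)) N) N*Σwindow≡0) ⟩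
    + 0                 ∎
    where
    open ≡-Reasoning
    Σr∘σ≡Σid : Σ (r n ∘ σ) ≡ Σ (λ i → i)
    Σr∘σ≡Σid = trans (Σ-∘-bijection σ τ σ-eq στ τσ (r n) (cong (+_ ∘ suc) ∘ residue-+N))
                     (sum-cong-≗ (λ k → cong (+_ ∘ suc) (proj₁ (residue-window-ι k))))
    Σσ≡Σid+N*Σwindow : Σ σ ≡ Σ (λ i → i) + N * Σ (window ∘ σ)
    Σσ≡Σid+N*Σwindow = begin
      Σ σ                                     ≡⟨ sum-cong-≗ (λ k → trans (decomposition (σ (ι k)))
                                                   (cong (_+_ (r n (σ (ι k)))) (ℤP.*-comm (window (σ (ι k))) N))) ⟩
      Σ (λ i → r n (σ i) + N * window (σ i))  ≡⟨ Σ-+-*ˡ (r n ∘ σ) N (window ∘ σ) ⟩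
      Σ (r n ∘ σ) + N * Σ (window ∘ σ)        ≡⟨ cong (_+ N * Σ (window ∘ σ)) Σr∘σ≡Σid ⟩
      Σ (λ i → i) + N * Σ (window ∘ σ)        ∎
    N*Σwindow≡0 : N * Σ (window ∘ σ) ≡ + 0 * N
    N*Σwindow≡0 = +-cancelˡ (Σ (λ i → i)) _ _
                    (trans (sym Σσ≡Σid+N*Σwindow) (trans Σσ≡Σid (sym (ℤP.+-identityʳ _))))

  sq : (ℤ → ℤ) → ℤ → ℤ
  sq f i = f i * f i

  sq-periodic : ∀ f → Periodic f → Periodic (sq f)
  sq-periodic f f-per i = cong₂ _*_ (f-per i) (f-per i)

  Σ-square-expand : ∀ (a b c : ℤ → ℤ) →
    Σ (sq (λ i → a i + b i - c i)) ≡
    Σ (sq a) + Σ (sq b) + Σ (sq c)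
      + + 2 * Σ (λ i → a i * b i) - + 2 * Σ (λ i → a i * c i) - + 2 * Σ (λ i → b i * c i)
  Σ-square-expand a b c = begin
    Σ (sq (λ i → a i + b i - c i))
      ≡⟨ sum-cong-≗ (λ k → e₁ (a (ι k)) (b (ι k)) (c (ι k))) ⟩
    Σ (λ i → t₃ i + - + 2 * bc i)
      ≡⟨ Σ-+-*ˡ t₃ (- + 2) bc ⟩
    Σ t₃ + - + 2 * Σ bc
      ≡⟨ cong (_+ - + 2 * Σ bc) (Σ-+-*ˡ t₂ (- + 2) ac) ⟩
    Σ t₂ + - + 2 * Σ ac + - + 2 * Σ bc
      ≡⟨ cong (λ u → u + - + 2 * Σ ac + - + 2 * Σ bc) (Σ-+-*ˡ t₁ (+ 2) ab) ⟩
    Σ t₁ + + 2 * Σ ab + - + 2 * Σ ac + - + 2 * Σ bc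
      ≡⟨ cong (λ u → u + + 2 * Σ ab + - + 2 * Σ ac + - + 2 * Σ bc)
              (trans (Σ-+ (λ i → sq a i + sq b i) (sq c)) (cong (_+ Σ (sq c)) (Σ-+ (sq a) (sq b)))) ⟩
    Σ (sq a) + Σ (sq b) + Σ (sq c) + + 2 * Σ ab + - + 2 * Σ ac + - + 2 * Σ bc
      ≡⟨ e₂ (Σ (sq a)) (Σ (sq b)) (Σ (sq c)) (Σ ab) (Σ ac) (Σ bc) ⟩
    Σ (sq a) + Σ (sq b) + Σ (sq c) + + 2 * Σ ab - + 2 * Σ ac - + 2 * Σ bc
      ∎
    where
    open ≡-Reasoning
    ab ac bc t₁ t₂ t₃ : ℤ → ℤ
    ab i = a i * b i
    ac i = a i * c i
    bc i = b i * c i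
    t₁ i = sq a i + sq b i + sq c i
    t₂ i = t₁ i + + 2 * ab i
    t₃ i = t₂ i + - + 2 * ac i
    e₁ : ∀ a b c → (a + b - c) * (a + b - c) ≡
                   a * a + b * b + c * c + + 2 * (a * b) + - + 2 * (a * c) + - + 2 * (b * c)
    e₁ = solve-∀
    e₂ : ∀ p q r x y z → p + q + r + + 2 * x + - + 2 * y + - + 2 * z ≡ p + q + r + + 2 * x - + 2 * y - + 2 * z
    e₂ = solve-∀

  module FixedPointFreeInvolution (z : ℤ → ℤ) (z-eq : Equivariant z)
                                  (z-inv : ∀ i → z (z i) ≡ i) (z-fpf : ∀ i → z i ≢ i) where

    residue-moved : ∀ i → residue i ≢ residue (z i)
    residue-moved i same = z-fpf i (begin
      z i          ≡⟨ zi≡i+mN ⟩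
      i + m * N    ≡⟨ cong (λ u → i + u * N) m≡0 ⟩
      i + + 0 * N  ≡⟨ ℤP.+-identityʳ i ⟩
      i            ∎)
      where
      open ≡-Reasoning
      m = window (z i) - window i
      zi≡i+mN : z i ≡ i + m * N
      zi≡i+mN = same-residue⇒+multiple (z i) i (sym same)
      i≡i+mN+mN : i ≡ i + m * N + m * N
      i≡i+mN+mN = begin
        i                  ≡⟨ z-inv i ⟨
        z (z i)            ≡⟨ cong z zi≡i+mN ⟩
        z (i + m * N)      ≡⟨ translate-by-multiple z N z-eq i m ⟩
        z i + m * N        ≡⟨ cong (_+ m * N) zi≡i+mN ⟩
        i + m * N + m * N  ∎
      e : ∀ i m N → (+ 2 * m) * N ≡ i + m * N + m * N - i
      e = solve-∀
      2m≡0 : + 2 * m ≡ + 2 * + 0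
      2m≡0 = ℤP.*-cancelʳ-≡ _ (+ 0) N
               (trans (e i m N) (trans (cong (_- i) (sym i≡i+mN+mN)) (ℤP.+-inverseʳ i)))
      m≡0 : m ≡ + 0
      m≡0 = ℤP.*-cancelˡ-≡ (+ 2) m (+ 0) 2m≡0

    -- As z pairs up the residues mod n, each pair {i, z i} is counted exactly once.
    lowerHalf : (ℤ → ℤ) → ℤ → ℤ
    lowerHalf g i = ifLess (residue i) (residue (z i)) (g i)

    lowerHalf-periodic : ∀ g → Periodic g → Periodic (lowerHalf g)
    lowerHalf-periodic g g-per i =
      trans (cong₂ (λ a b → ifLess a b (g (i + N))) (residue-+N i) (trans (cong residue (z-eq i)) (residue-+N (z i))))
            (cong (ifLess (residue i) (residue (z i))) (g-per i))

    Σ-invariant≡2*Σ-lowerHalf : ∀ g → Periodic g → (∀ i → g (z i) ≡ g i) → Σ g ≡ + 2 * Σ (lowerHalf g)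
    Σ-invariant≡2*Σ-lowerHalf g g-per g-inv = begin
      Σ g                                    ≡⟨ sum-cong-≗ (λ k → ≢⇒≡ifLess+ifLess (g (ι k)) (residue-moved (ι k))) ⟩
      Σ (λ i → lowerHalf g i + upperHalf i)  ≡⟨ Σ-+ (lowerHalf g) upperHalf ⟩
      Σ (lowerHalf g) + Σ upperHalf          ≡⟨ cong (_+_ (Σ (lowerHalf g))) (sum-cong-≗ (lowerHalf∘z ∘ ι)) ⟨
      Σ (lowerHalf g) + Σ (lowerHalf g ∘ z)  ≡⟨ cong (_+_ (Σ (lowerHalf g))) Σ-lowerHalf∘z ⟩
      Σ (lowerHalf g) + Σ (lowerHalf g)      ≡⟨ e (Σ (lowerHalf g)) ⟩
      + 2 * Σ (lowerHalf g)                  ∎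
      where
      open ≡-Reasoning
      upperHalf : ℤ → ℤ
      upperHalf i = ifLess (residue (z i)) (residue i) (g i)
      lowerHalf∘z : ∀ i → lowerHalf g (z i) ≡ upperHalf i
      lowerHalf∘z i = cong₂ (ifLess (residue (z i))) (cong residue (z-inv i)) (g-inv i)
      Σ-lowerHalf∘z : Σ (lowerHalf g ∘ z) ≡ Σ (lowerHalf g)
      Σ-lowerHalf∘z = Σ-∘-bijection z z z-eq z-inv z-inv (lowerHalf g) (lowerHalf-periodic g g-per)
      e : ∀ a → a + a ≡ + 2 * a
      e = solve-∀

    δ : ℤ → ℤ
    δ = displacement z

    δ∘z≡-δ : ∀ i → δ (z i) ≡ - δ i
    δ∘z≡-δ i = trans (cong (λ u → window u - window (z i)) (z-inv i)) (e (window i) (window (z i)))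
      where
      e : ∀ a b → a - b ≡ - (b - a)
      e = solve-∀

    ∣δ∣ : ℤ → ℤ
    ∣δ∣ i = + ∣ δ i ∣

    ∣δ∣-periodic : Periodic ∣δ∣
    ∣δ∣-periodic i = cong (+_ ∘ ∣_∣) (displacement-periodic z z-eq i)

    ∣δ∣∘z≡∣δ∣ : ∀ i → ∣δ∣ (z i) ≡ ∣δ∣ i
    ∣δ∣∘z≡∣δ∣ i = trans (cong (+_ ∘ ∣_∣) (δ∘z≡-δ i)) (cong +_ (ℤP.∣-i∣≡∣i∣ (δ i)))

    halfΣ∣δ∣ : ℤ
    halfΣ∣δ∣ = Σ (lowerHalf ∣δ∣)

    Σ∣δ∣≡2*halfΣ∣δ∣ : Σ ∣δ∣ ≡ + 2 * halfΣ∣δ∣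
    Σ∣δ∣≡2*halfΣ∣δ∣ = Σ-invariant≡2*Σ-lowerHalf ∣δ∣ ∣δ∣-periodic ∣δ∣∘z≡∣δ∣

    β≡∣halfΣ∣δ∣∣ : β n z ≡ ∣ halfΣ∣δ∣ ∣
    β≡∣halfΣ∣δ∣∣ = trans (cong (λ m → ℕ._/_ m (2 ℕ.* n) {{ℕP.m*n≢0 2 n}}) βsum≡)
                        (ℕDM.m*n/n≡m ∣ halfΣ∣δ∣ ∣ (2 ℕ.* n) {{ℕP.m*n≢0 2 n}})
      where
      open ≡-Reasoning
      e : ∀ h n → n ℕ.* (2 ℕ.* h) ≡ h ℕ.* (2 ℕ.* n)
      e = ℕSolver.solve-∀
      βsum≡ : βsum n z ≡ ∣ halfΣ∣δ∣ ∣ ℕ.* (2 ℕ.* n)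
      βsum≡ = begin
        βsum n z                    ≡⟨ cong ∣_∣ (sumℤ-distance-to-r≡N*Σ∣displacement∣ z) ⟩
        ∣ N * Σ ∣δ∣ ∣                ≡⟨ cong (∣_∣ ∘ (N *_)) Σ∣δ∣≡2*halfΣ∣δ∣ ⟩
        ∣ N * (+ 2 * halfΣ∣δ∣) ∣     ≡⟨ ℤP.abs-* N (+ 2 * halfΣ∣δ∣) ⟩
        n ℕ.* ∣ + 2 * halfΣ∣δ∣ ∣     ≡⟨ cong (n ℕ.*_) (ℤP.abs-* (+ 2) halfΣ∣δ∣) ⟩
        n ℕ.* (2 ℕ.* ∣ halfΣ∣δ∣ ∣)   ≡⟨ e ∣ halfΣ∣δ∣ ∣ n ⟩
        ∣ halfΣ∣δ∣ ∣ ℕ.* (2 ℕ.* n)   ∎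

    sgnFPF≡altSign-halfΣ∣δ∣ : sgnFPF n z ≡ altSign halfΣ∣δ∣
    sgnFPF≡altSign-halfΣ∣δ∣ = cong (-1ℤ ℤ.^_) β≡∣halfΣ∣δ∣∣

    halfΣchoose₂∣δ∣ : ℤ
    halfΣchoose₂∣δ∣ = Σ (lowerHalf (choose₂ℤ ∘ ∣δ∣))

    Σδ²≡2*halfΣ∣δ∣+4*halfΣchoose₂∣δ∣ : Σ (sq δ) ≡ + 2 * halfΣ∣δ∣ + + 4 * halfΣchoose₂∣δ∣
    Σδ²≡2*halfΣ∣δ∣+4*halfΣchoose₂∣δ∣ = begin
      Σ (sq δ)                                        ≡⟨ sum-cong-≗ (square≡abs+2*choose₂ ∘ δ ∘ ι) ⟩
      Σ (λ i → ∣δ∣ i + + 2 * choose₂ℤ (∣δ∣ i))        ≡⟨ Σ-+-*ˡ ∣δ∣ (+ 2) (choose₂ℤ ∘ ∣δ∣) ⟩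
      Σ ∣δ∣ + + 2 * Σ (choose₂ℤ ∘ ∣δ∣)                ≡⟨ cong₂ (λ a b → a + + 2 * b) Σ∣δ∣≡2*halfΣ∣δ∣ Σchoose₂∣δ∣≡ ⟩
      + 2 * halfΣ∣δ∣ + + 2 * (+ 2 * halfΣchoose₂∣δ∣)  ≡⟨ e halfΣ∣δ∣ halfΣchoose₂∣δ∣ ⟩
      + 2 * halfΣ∣δ∣ + + 4 * halfΣchoose₂∣δ∣          ∎
      where
      open ≡-Reasoning
      Σchoose₂∣δ∣≡ : Σ (choose₂ℤ ∘ ∣δ∣) ≡ + 2 * halfΣchoose₂∣δ∣
      Σchoose₂∣δ∣≡ = Σ-invariant≡2*Σ-lowerHalf (choose₂ℤ ∘ ∣δ∣)
                       (cong choose₂ℤ ∘ ∣δ∣-periodic) (cong choose₂ℤ ∘ ∣δ∣∘z≡∣δ∣)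
      e : ∀ a b → + 2 * a + + 2 * (+ 2 * b) ≡ + 2 * a + + 4 * b
      e = solve-∀

  module Conjugation (z : ℤ → ℤ) (z-eq : Equivariant z) (z-inv : ∀ i → z (z i) ≡ i) (z-fpf : ∀ i → z i ≢ i)
                     (w w⁻¹ : ℤ → ℤ) (w-eq : Equivariant w)
                     (ww⁻¹ : ∀ i → w (w⁻¹ i) ≡ i) (w⁻¹w : ∀ i → w⁻¹ (w i) ≡ i)
                     (Σw≡Σid : Σ w ≡ Σ (λ i → i)) where

    z′ : ℤ → ℤ
    z′ = w ∘ z ∘ w⁻¹

    z′-eq : Equivariant z′
    z′-eq i = begin
      w (z (w⁻¹ (i + N)))  ≡⟨ cong (w ∘ z) (inverse-equivariant w w⁻¹ w-eq ww⁻¹ w⁻¹w i) ⟩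
      w (z (w⁻¹ i + N))    ≡⟨ cong w (z-eq (w⁻¹ i)) ⟩
      w (z (w⁻¹ i) + N)    ≡⟨ w-eq (z (w⁻¹ i)) ⟩
      w (z (w⁻¹ i)) + N    ∎
      where open ≡-Reasoning

    z′-inv : ∀ i → z′ (z′ i) ≡ i
    z′-inv i = begin
      w (z (w⁻¹ (w (z (w⁻¹ i)))))  ≡⟨ cong (w ∘ z) (w⁻¹w (z (w⁻¹ i))) ⟩
      w (z (z (w⁻¹ i)))            ≡⟨ cong w (z-inv (w⁻¹ i)) ⟩
      w (w⁻¹ i)                    ≡⟨ ww⁻¹ i ⟩
      i                            ∎
      where open ≡-Reasoning

    z′-fpf : ∀ i → z′ i ≢ i
    z′-fpf i z′i≡i = z-fpf (w⁻¹ i) (trans (sym (w⁻¹w (z (w⁻¹ i)))) (cong w⁻¹ z′i≡i))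

    module Z = FixedPointFreeInvolution z z-eq z-inv z-fpf
    module Z′ = FixedPointFreeInvolution z′ z′-eq z′-inv z′-fpf

    δw : ℤ → ℤ
    δw = displacement w

    δw-periodic : Periodic δw
    δw-periodic = displacement-periodic w w-eq

    δw∘z-periodic : Periodic (δw ∘ z)
    δw∘z-periodic i = trans (cong δw (z-eq i)) (δw-periodic (z i))

    δ′∘w : ∀ j → Z′.δ (w j) ≡ Z.δ j + δw (z j) - δw j
    δ′∘w j = trans (cong (λ u → window (w (z u)) - window (w j)) (w⁻¹w j))
                   (e (window (w (z j))) (window (w j)) (window (z j)) (window j))
      where
      e : ∀ a b c d → a - b ≡ c - d + (a - c) - (b - d)
      e = solve-∀

    Σδw²≡2*Σchoose₂δw : Σ (sq δw) ≡ + 2 * Σ (choose₂ℤ ∘ δw)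
    Σδw²≡2*Σchoose₂δw = begin
      Σ (sq δw)                               ≡⟨ sum-cong-≗ (square≡self+2*choose₂ ∘ δw ∘ ι) ⟩
      Σ (λ i → δw i + + 2 * choose₂ℤ (δw i))  ≡⟨ Σ-+-*ˡ δw (+ 2) (choose₂ℤ ∘ δw) ⟩
      Σ δw + + 2 * Σ (choose₂ℤ ∘ δw)          ≡⟨ cong (_+ + 2 * Σ (choose₂ℤ ∘ δw)) Σδw≡0 ⟩
      + 0 + + 2 * Σ (choose₂ℤ ∘ δw)           ≡⟨ ℤP.+-identityˡ _ ⟩
      + 2 * Σ (choose₂ℤ ∘ δw)                 ∎
      where
      open ≡-Reasoning
      Σδw≡0 : Σ δw ≡ + 0
      Σδw≡0 = Σ-displacement≡0 w w⁻¹ w-eq ww⁻¹ w⁻¹w Σw≡Σid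

    Σ[δw∘z]²≡Σδw² : Σ (sq (δw ∘ z)) ≡ Σ (sq δw)
    Σ[δw∘z]²≡Σδw² = Σ-∘-bijection z z z-eq z-inv z-inv (sq δw) (sq-periodic δw δw-periodic)

    Σδ·δw∘z≡-Σδ·δw : Σ (λ i → Z.δ i * δw (z i)) ≡ - Σ (λ i → Z.δ i * δw i)
    Σδ·δw∘z≡-Σδ·δw = begin
      Σ (λ i → Z.δ i * δw (z i))
        ≡⟨ Σ-∘-bijection z z z-eq z-inv z-inv (λ i → Z.δ i * δw (z i))
             (λ i → cong₂ _*_ (displacement-periodic z z-eq i) (δw∘z-periodic i)) ⟨
      Σ (λ i → Z.δ (z i) * δw (z (z i)))
        ≡⟨ sum-cong-≗ (λ k → cong₂ _*_ (Z.δ∘z≡-δ (ι k)) (cong δw (z-inv (ι k)))) ⟩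
      Σ (λ i → - Z.δ i * δw i)
        ≡⟨ sum-cong-≗ (λ k → trans (ℤP.-1*i≡-i _) (ℤP.neg-distribˡ-* (Z.δ (ι k)) (δw (ι k)))) ⟨
      Σ (λ i → -1ℤ * (Z.δ i * δw i))
        ≡⟨ Σ-*ˡ -1ℤ (λ i → Z.δ i * δw i) ⟩
      -1ℤ * Σ (λ i → Z.δ i * δw i)
        ≡⟨ ℤP.-1*i≡-i _ ⟩
      - Σ (λ i → Z.δ i * δw i)
        ∎
      where open ≡-Reasoning

    Σδw∘z·δw≡2*halfΣ : Σ (λ i → δw (z i) * δw i) ≡ + 2 * Σ (Z.lowerHalf (λ i → δw (z i) * δw i))
    Σδw∘z·δw≡2*halfΣ = Z.Σ-invariant≡2*Σ-lowerHalf (λ i → δw (z i) * δw i)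
      (λ i → cong₂ _*_ (δw∘z-periodic i) (δw-periodic i))
      (λ i → trans (cong (λ u → δw u * δw (z i)) (z-inv i)) (ℤP.*-comm (δw i) (δw (z i))))

    quarterChange : ℤ
    quarterChange = Σ (choose₂ℤ ∘ δw) - Σ (λ i → Z.δ i * δw i) - Σ (Z.lowerHalf (λ i → δw (z i) * δw i))

    Σδ′²≡Σδ²+4*quarterChange : Σ (sq Z′.δ) ≡ Σ (sq Z.δ) + + 4 * quarterChange
    Σδ′²≡Σδ²+4*quarterChange = begin
      Σ (sq Z′.δ)
        ≡⟨ Σ-∘-bijection w w⁻¹ w-eq ww⁻¹ w⁻¹w (sq Z′.δ)
             (sq-periodic Z′.δ (displacement-periodic z′ z′-eq)) ⟨
      Σ (sq Z′.δ ∘ w)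
        ≡⟨ sum-cong-≗ (λ k → cong₂ _*_ (δ′∘w (ι k)) (δ′∘w (ι k))) ⟩
      Σ (sq (λ i → Z.δ i + δw (z i) - δw i))
        ≡⟨ Σ-square-expand Z.δ (δw ∘ z) δw ⟩
      Σ (sq Z.δ) + Σ (sq (δw ∘ z)) + Σ (sq δw) + + 2 * Σ (λ i → Z.δ i * δw (z i)) - + 2 * P - + 2 * Σ zww
        ≡⟨ cong₂ (λ u v → Σ (sq Z.δ) + u + Σ (sq δw) + + 2 * v - + 2 * P - + 2 * Σ zww)
                 Σ[δw∘z]²≡Σδw² Σδ·δw∘z≡-Σδ·δw ⟩
      Σ (sq Z.δ) + Σ (sq δw) + Σ (sq δw) + + 2 * - P - + 2 * P - + 2 * Σ zww
        ≡⟨ cong₂ (λ u v → Σ (sq Z.δ) + u + u + + 2 * - P - + 2 * P - + 2 * v)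
                 Σδw²≡2*Σchoose₂δw Σδw∘z·δw≡2*halfΣ ⟩
      Σ (sq Z.δ) + + 2 * X + + 2 * X + + 2 * - P - + 2 * P - + 2 * (+ 2 * Y)
        ≡⟨ e (Σ (sq Z.δ)) X P Y ⟩
      Σ (sq Z.δ) + + 4 * quarterChange
        ∎
      where
      open ≡-Reasoning
      zww : ℤ → ℤ
      zww i = δw (z i) * δw i
      X P Y : ℤ
      X = Σ (choose₂ℤ ∘ δw)
      P = Σ (λ i → Z.δ i * δw i)
      Y = Σ (Z.lowerHalf zww)
      e : ∀ a x p y → a + + 2 * x + + 2 * x + + 2 * - p - + 2 * p - + 2 * (+ 2 * y) ≡ a + + 4 * (x - p - y)
      e = solve-∀

    halfΣ∣δ′∣≡halfΣ∣δ∣+even :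
      Z′.halfΣ∣δ∣ ≡ Z.halfΣ∣δ∣ + + 2 * (Z.halfΣchoose₂∣δ∣ + quarterChange - Z′.halfΣchoose₂∣δ∣)
    halfΣ∣δ′∣≡halfΣ∣δ∣+even = ℤP.*-cancelˡ-≡ (+ 2) _ _ (begin
      + 2 * H′
        ≡⟨ e₁ H′ C′ ⟩
      + 2 * H′ + + 4 * C′ - + 4 * C′
        ≡⟨ cong (_- + 4 * C′) Z′.Σδ²≡2*halfΣ∣δ∣+4*halfΣchoose₂∣δ∣ ⟨
      Σ (sq Z′.δ) - + 4 * C′
        ≡⟨ cong (_- + 4 * C′) Σδ′²≡Σδ²+4*quarterChange ⟩
      Σ (sq Z.δ) + + 4 * q - + 4 * C′
        ≡⟨ cong (λ u → u + + 4 * q - + 4 * C′) Z.Σδ²≡2*halfΣ∣δ∣+4*halfΣchoose₂∣δ∣ ⟩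
      + 2 * H + + 4 * C + + 4 * q - + 4 * C′
        ≡⟨ e₂ H C q C′ ⟩
      + 2 * (H + + 2 * (C + q - C′))
        ∎)
      where
      open ≡-Reasoning
      H H′ C C′ q : ℤ
      H = Z.halfΣ∣δ∣
      H′ = Z′.halfΣ∣δ∣
      C = Z.halfΣchoose₂∣δ∣
      C′ = Z′.halfΣchoose₂∣δ∣
      q = quarterChange
      e₁ : ∀ h c → + 2 * h ≡ + 2 * h + + 4 * c - + 4 * c
      e₁ = solve-∀
      e₂ : ∀ h c q c′ → + 2 * h + + 4 * c + + 4 * q - + 4 * c′ ≡ + 2 * (h + + 2 * (c + q - c′))
      e₂ = solve-∀

    sgnFPF-conjugate : sgnFPF n z′ ≡ sgnFPF n z
    sgnFPF-conjugate = begin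
      sgnFPF n z′                     ≡⟨ Z′.sgnFPF≡altSign-halfΣ∣δ∣ ⟩
      altSign Z′.halfΣ∣δ∣             ≡⟨ cong altSign halfΣ∣δ′∣≡halfΣ∣δ∣+even ⟩
      altSign (Z.halfΣ∣δ∣ + + 2 * _)  ≡⟨ altSign-+-even Z.halfΣ∣δ∣ _ ⟩
      altSign Z.halfΣ∣δ∣              ≡⟨ Z.sgnFPF≡altSign-halfΣ∣δ∣ ⟨
      sgnFPF n z                      ∎
      where open ≡-Reasoning

-- Evenness of n is what makes Ĩ^FPF_n nonempty; the argument itself does not use 2 ≤ n or 2 ∣ n.
lemma3p3 : (n : ℕ) .{{_ : NonZero n}} → 2 ≤ n → 2 ∣ n →
           (z : ℤ → ℤ) → IsAffineFPFInvolution n z →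
           (w w⁻¹ : ℤ → ℤ) → IsAffinePerm n w →
           (∀ i → w (w⁻¹ i) ≡ i) → (∀ i → w⁻¹ (w i) ≡ i) →
           sgnFPF n (w ∘ z ∘ w⁻¹) ≡ sgnFPF n z
lemma3p3 n _ _ z ((_ , z-eq , _) , z-inv , z-fpf) w w⁻¹ (_ , w-eq , sumℤw≡sumℤid) ww⁻¹ w⁻¹w =
  Conjugation.sgnFPF-conjugate z z-eq z-inv z-fpf w w⁻¹ w-eq ww⁻¹ w⁻¹w Σw≡Σid
  where
  open Windows n
  Σw≡Σid : Σ w ≡ Σ (λ i → i)
  Σw≡Σid = trans (sym (sumℤ≡Σ w)) (trans sumℤw≡sumℤid (sumℤ≡Σ (λ i → i)))
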